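{- Every instance of the schema $\phi\to[\boxdot\phi\to(\boxdot(\phi\to\psi)\to\boxdot\psi)]$ (with $\phi,\psi\in\mathcal{L}(\boxdot)$) is valid on the class of reflexive bimodal frames.
   Context: Fix a nonempty set $\mathbf{P}$ of propositional variables; $\mathcal{L}(\boxdot)$ is given by $\phi::=p\mid\neg\phi\mid(\phi\land\phi)\mid\boxdot\phi$, $p\in\mathbf{P}$. A bimodal frame is $\langle S,R_1,R_2\rangle$ with $S$ nonempty and $R_1,R_2\subseteq S\times S$; a model adds $V:\mathbf{P}\to\mathcal{P}(S)$; the frame is reflexive if both $R_1$ and $R_2$ are reflexive. $\mathcal{M},s\vDash\boxdot\phi$ iff for all $t,u$ with $sR_1t$ and $sR_2u$, $(\mathcal{M},t\vDash\phi\iff\mathcal{M},u\vDash\phi)$; Boolean clauses as usual. Valid on a class of frames: true at every point of every model based on a frame in the class. -}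

module Defs where

open import Data.Product using (_×_; Σ)
open import Data.Empty using (⊥)
open import Data.Bool using (Bool; true)
open import Relation.Binary.PropositionalEquality using (_≡_)
open import Relation.Nullary using (¬_)
open import Relation.Binary.Core using (Rel)
open import Relation.Binary.Definitions using (Reflexive)
open import Function.Bundles using (_⇔_)
open import Level using (0ℓ)

data Form (P : Set) : Set where
  var  : P → Form P
  ¬'_  : Form P → Form P
  _∧'_ : Form P → Form P → Form P
  ⊡_   : Form P → Form P

infixr 6 _∧'_
infixr 5 _→'_

_→'_ : {P : Set} → Form P → Form P → Form P
φ →' ψ = ¬' (φ ∧' ¬' ψ)

record Frame : Set₁ where
  field
    S   : Set
    pt  : S                 -- nonemptiness witness
    R₁  : Rel S 0ℓ
    R₂  : Rel S 0ℓ

IsReflexive : Frame → Set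
IsReflexive F = Reflexive (Frame.R₁ F) × Reflexive (Frame.R₂ F)

-- Models: a frame with a valuation V : P → 𝒫(S); subsets of S are
-- represented classically as characteristic functions S → Bool.
record Model (P : Set) : Set₁ where
  field
    frame : Frame
  open Frame frame public
  field
    V : P → S → Bool

_,_⊨_ : {P : Set} (M : Model P) → Model.S M → Form P → Set
M , s ⊨ var p    = Model.V M p s ≡ true
M , s ⊨ (¬' φ)   = ¬ (M , s ⊨ φ)
M , s ⊨ (φ ∧' ψ) = (M , s ⊨ φ) × (M , s ⊨ ψ)
M , s ⊨ (⊡ φ)    = ∀ t u → Model.R₁ M s t → Model.R₂ M s u →
                     ((M , t ⊨ φ) ⇔ (M , u ⊨ φ))

ValidOn : {P : Set} → (Frame → Set) → Form P → Set₁
ValidOn {P} C φ = (M : Model P) → C (Model.frame M) → (s : Model.S M) → M , s ⊨ φ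

module Submission where

-- Fix a point s with φ true at s and ⊡φ true at s.  Reflexivity
-- puts s among both its R₁- and its R₂-successors, so ⊡φ forces every
-- R₁-successor and every R₂-successor of s to agree with s on φ; hence φ
-- holds at all of them.  Now ⊡(φ → ψ) says that φ → ψ has the same truth
-- value at any R₁-successor t and R₂-successor u; since φ holds at both,
-- φ → ψ is equivalent to ψ there, so ψ agrees at t and u, i.e. ⊡ψ.
--
-- Because satisfaction is interpreted in Agda's constructive logic, the
-- defined implication φ →' ψ = ¬(φ ∧ ¬ψ) is only classically an
-- implication.

open import Defs
open import Data.Product using (_,_; proj₁; proj₂)
open import Data.Empty using (⊥-elim)
open import Data.Bool using (true; false)
open import Relation.Binary.PropositionalEquality using (refl)
open import Relation.Nullary using (¬_)
open import Function.Bundles using (_⇔_; mk⇔; Equivalence)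

open Equivalence using (to; from)

module _ {P : Set} (M : Model P) where

  open Model M using (S; V; R₁; R₂)

  -- Satisfaction is ¬¬-stable: every clause of _,_⊨_ is a negation, a
  -- product or a function into stable types, or a decidable Bool equation.
  ⊨-stable : (s : S) (φ : Form P) → ¬ ¬ (M , s ⊨ φ) → M , s ⊨ φ
  ⊨-stable s (var p) nn with V p s
  ... | true  = refl
  ... | false = ⊥-elim (nn (λ ()))
  ⊨-stable s (¬' φ) nn sat = nn (λ unsat → unsat sat)
  ⊨-stable s (φ ∧' ψ) nn =
    ⊨-stable s φ (λ k → nn (λ both → k (proj₁ both))) ,
    ⊨-stable s ψ (λ k → nn (λ both → k (proj₂ both)))
  ⊨-stable s (⊡ φ) nn t u tR₁ uR₂ =
    mk⇔ (λ φt → ⊨-stable u φ (λ k → nn (λ box → k (to   (box t u tR₁ uR₂) φt))))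
        (λ φu → ⊨-stable t φ (λ k → nn (λ box → k (from (box t u tR₁ uR₂) φu))))

  →'-elim : (s : S) (φ ψ : Form P) → M , s ⊨ (φ →' ψ) → M , s ⊨ φ → M , s ⊨ ψ
  →'-elim s φ ψ imp φs = ⊨-stable s ψ (λ ¬ψs → imp (φs , ¬ψs))

  →'-intro : (s : S) (φ ψ : Form P) → (M , s ⊨ φ → M , s ⊨ ψ) → M , s ⊨ (φ →' ψ)
  →'-intro s φ ψ f (φs , ¬ψs) = ¬ψs (f φs)

  →'-under : (s : S) (φ ψ : Form P) → M , s ⊨ φ → (M , s ⊨ (φ →' ψ)) ⇔ (M , s ⊨ ψ)
  →'-under s φ ψ φs = mk⇔ (λ imp → →'-elim s φ ψ imp φs) (λ ψs → →'-intro s φ ψ (λ _ → ψs))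

  -- On a reflexive frame, if φ and ⊡φ hold at s, then φ holds at every
  -- R₁-successor (compare with s as its own R₂-successor) and every
  -- R₂-successor (compare with s as its own R₁-successor).
  module _ (refl₁ : ∀ {x} → R₁ x x) (refl₂ : ∀ {x} → R₂ x x)
           (s : S) (φ : Form P) (φs : M , s ⊨ φ) (⊡φs : M , s ⊨ (⊡ φ)) where

    spread₁ : ∀ t → R₁ s t → M , t ⊨ φ
    spread₁ t tR₁ = from (⊡φs t s tR₁ refl₂) φs

    spread₂ : ∀ u → R₂ s u → M , u ⊨ φ
    spread₂ u uR₂ = to (⊡φs s u refl₁ uR₂) φs

    -- The schema's conclusion at s: ⊡(φ → ψ) yields ⊡ψ, because at every
    -- successor φ → ψ and ψ have the same truth value.
    ⊡-transfer : (ψ : Form P) → M , s ⊨ (⊡ (φ →' ψ)) → M , s ⊨ (⊡ ψ)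
    ⊡-transfer ψ ⊡imp t u tR₁ uR₂ =
      mk⇔ (λ ψt → to (→'-under u φ ψ φu) (to (⊡imp t u tR₁ uR₂) (from (→'-under t φ ψ φt) ψt)))
          (λ ψu → to (→'-under t φ ψ φt) (from (⊡imp t u tR₁ uR₂) (from (→'-under u φ ψ φu) ψu)))
      where
      φt = spread₁ t tR₁
      φu = spread₂ u uR₂

proposition7p16 : (P : Set) → P → (φ ψ : Form P) →
    ValidOn IsReflexive (φ →' (⊡ φ →' (⊡ (φ →' ψ) →' ⊡ ψ)))
proposition7p16 P _ φ ψ M (refl₁ , refl₂) s =
  →'-intro M s φ (⊡ φ →' (⊡ (φ →' ψ) →' ⊡ ψ)) λ φs →
  →'-intro M s (⊡ φ) (⊡ (φ →' ψ) →' ⊡ ψ) λ ⊡φs →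
  →'-intro M s (⊡ (φ →' ψ)) (⊡ ψ) (⊡-transfer M refl₁ refl₂ s φ φs ⊡φs ψ)
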